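{- Let $G$ be a finite simple graph. Every vertex $v$ of $G$ is ds-completable if and only if there are no two vertices of $G$ whose degrees differ by exactly $1$.
   Context: For a vertex $v$ of a graph $G$, the card $G-v$ is the vertex-deleted subgraph. The vertex $v$ is called ds-completable if, for each integer $d$, the vertices having degree $d$ in $G-v$ are either all neighbours of $v$ in $G$ or all non-neighbours of $v$ in $G$. -}

module Defs where

open import Data.Nat using (ℕ; zero; suc; _+_)
open import Data.Bool using (Bool; true; false; if_then_else_)
open import Data.Fin using (Fin; zero; suc; punchIn)
open import Data.Sum using (_⊎_)
open import Data.Unit using (⊤)
open import Relation.Binary.PropositionalEquality using (_≡_)
open import Relation.Nullary using (¬_)

record Graph (n : ℕ) : Set where
  field
    adj   : Fin n → Fin n → Bool
    sym   : ∀ u w → adj u w ≡ adj w u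
    irrefl : ∀ u → adj u u ≡ false
open Graph public

sumFin : (n : ℕ) → (Fin n → ℕ) → ℕ
sumFin zero    f = 0
sumFin (suc n) f = f zero + sumFin n (λ i → f (suc i))

degree : {n : ℕ} → Graph n → Fin n → ℕ
degree {n} G u = sumFin n (λ w → if adj G u w then 1 else 0)

-- The card G - v: the vertex-deleted subgraph, with vertex set Fin n
-- identified with the vertices of G other than v via punchIn v.
card : {n : ℕ} → Graph (suc n) → Fin (suc n) → Graph n
card G v = record
  { adj    = λ i j → adj G (punchIn v i) (punchIn v j)
  ; sym    = λ i j → sym G (punchIn v i) (punchIn v j)
  ; irrefl = λ i → irrefl G (punchIn v i)
  }

dsCompletable : {n : ℕ} → Graph (suc n) → Fin (suc n) → Set
dsCompletable {n} G v =
  (d : ℕ) →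
    ((u : Fin n) → degree (card G v) u ≡ d → adj G v (punchIn v u) ≡ true)
    ⊎ ((u : Fin n) → degree (card G v) u ≡ d → adj G v (punchIn v u) ≡ false)

allDsCompletable : {n : ℕ} → Graph n → Set
allDsCompletable {zero}  G = ⊤
allDsCompletable {suc n} G = (v : Fin (suc n)) → dsCompletable G v

module Submission where

-- Removing v from G lowers the degree of every neighbour of v
-- by one and leaves every other degree unchanged (degree-of-neighbour,
-- degree-of-non-neighbour).  Call a pair of vertices a, b of the card G - v
-- a splitting pair at v if they have equal degree in G - v while a is a
-- neighbour of v and b is not.  Then
--   * v is ds-completable iff there is no splitting pair at v
--     (splitting-pair⇒not-ds, no-splitting-pair⇒ds);
--   * a splitting pair at v is a pair of vertices of G whose degrees differ
--     by exactly one (splitting-pair⇒gap);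
--   * conversely, if deg u = deg w + 1 then u has a neighbour v ≠ w that is
--     not a neighbour of w, by counting neighbours (escaping-neighbour), and
--     u, w form a splitting pair at v (gap⇒splitting-pair).

open import Defs hiding (sym)
open import Data.Nat using (ℕ; zero; suc; _+_; _≤_; _<_; z≤n; s≤s; _<?_) renaming (_≟_ to _≟ℕ_)
open import Data.Nat.Properties
  using (+-mono-≤; +-suc; +-cancelˡ-≡; suc-injective; ≮⇒≥; <⇒≱; n≮0; n<1+n; +-commutativeSemigroup)
open import Algebra.Properties.CommutativeSemigroup +-commutativeSemigroup using (x∙yz≈y∙xz)
open import Data.Bool using (Bool; true; false; if_then_else_)
open import Data.Bool.Properties using (¬-not) renaming (_≟_ to _≟ᴮ_)
open import Data.Fin using (Fin; zero; suc; punchIn; punchOut)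
open import Data.Fin.Properties using (_≟_; any?; punchIn-punchOut)
open import Data.Product using (∃; ∃₂; _×_; _,_)
open import Data.Sum using (inj₁; inj₂)
open import Data.Unit using (tt)
open import Data.Empty using (⊥-elim)
open import Function using (_∘_)
open import Function.Bundles using (_⇔_; mk⇔)
open import Relation.Binary.PropositionalEquality
  using (_≡_; _≢_; refl; sym; trans; cong; subst; module ≡-Reasoning)
open import Relation.Nullary using (¬_; yes; no; does)
open import Relation.Nullary.Decidable using (_×-dec_)

ind : Bool → ℕ
ind b = if b then 1 else 0

ind-< : ∀ {a b} → ind a < ind b → a ≡ false × b ≡ true
ind-< {false} {true} _ = refl , refl
ind-< {true}  {true} (s≤s ())

without : ∀ {n} → Fin n → (Fin n → ℕ) → Fin n → ℕ
without w f x = if does (x ≟ w) then 0 else f x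

sum-without : ∀ n (f : Fin n → ℕ) w → sumFin n f ≡ f w + sumFin n (without w f)
sum-without (suc n) f zero    = refl
sum-without (suc n) f (suc w) = begin
  f zero + sumFin n (f ∘ suc)
    ≡⟨ cong (f zero +_) (sum-without n (f ∘ suc) w) ⟩
  f zero + (f (suc w) + sumFin n (without w (f ∘ suc)))
    ≡⟨ x∙yz≈y∙xz (f zero) (f (suc w)) _ ⟩
  f (suc w) + (f zero + sumFin n (without w (f ∘ suc)))
    ∎
  where open ≡-Reasoning

sum-punchIn : ∀ n (f : Fin (suc n) → ℕ) v → sumFin (suc n) f ≡ f v + sumFin n (f ∘ punchIn v)
sum-punchIn n       f zero    = refl
sum-punchIn (suc n) f (suc v) = begin
  f zero + sumFin (suc n) (f ∘ suc)
    ≡⟨ cong (f zero +_) (sum-punchIn n (f ∘ suc) v) ⟩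
  f zero + (f (suc v) + sumFin n (f ∘ suc ∘ punchIn v))
    ≡⟨ x∙yz≈y∙xz (f zero) (f (suc v)) _ ⟩
  f (suc v) + (f zero + sumFin n (f ∘ suc ∘ punchIn v))
    ∎
  where open ≡-Reasoning

sum-mono : ∀ n (f g : Fin n → ℕ) → (∀ x → f x ≤ g x) → sumFin n f ≤ sumFin n g
sum-mono zero    f g f≤g = z≤n
sum-mono (suc n) f g f≤g = +-mono-≤ (f≤g zero) (sum-mono n (f ∘ suc) (g ∘ suc) (f≤g ∘ suc))

sum-<-witness : ∀ n (f g : Fin n → ℕ) → sumFin n f < sumFin n g → ∃ λ x → f x < g x
sum-<-witness n f g Σf<Σg with any? (λ x → f x <? g x)
... | yes witness = witness
... | no none     = ⊥-elim (<⇒≱ Σf<Σg (sum-mono n g f λ x → ≮⇒≥ (none ∘ (x ,_))))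

module _ {n : ℕ} (G : Graph n) where

  row : Fin n → Fin n → ℕ
  row u x = ind (adj G u x)

  DegreeGap : Set
  DegreeGap = ∃₂ λ (u w : Fin n) → degree G u ≡ suc (degree G w)

  degree-without : ∀ u w → degree G u ≡ ind (adj G u w) + sumFin n (without w (row u))
  degree-without u w = sum-without n (row u) w

  escaping-neighbour : ∀ u w x → without u (row w) x < without w (row u) x →
    x ≢ w × adj G u x ≡ true × adj G w x ≡ false
  escaping-neighbour u w x lt with x ≟ w | x ≟ u
  ... | yes _   | _        = ⊥-elim (n≮0 lt)
  ... | no _    | yes refl = ⊥-elim (n≮0 (subst (λ b → 0 < ind b) (irrefl G x) lt))
  ... | no x≢w  | no _     with ind-< lt
  ...   | w≁x , u~x = x≢w , u~x , w≁x

  -- If deg u = deg w + 1, then u has more neighbours outside {w} than w has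
  -- outside {u}, since u ~ w exactly when w ~ u.
  gap⇒without-gap : ∀ u w → degree G u ≡ suc (degree G w) →
    sumFin n (without u (row w)) < sumFin n (without w (row u))
  gap⇒without-gap u w gap = subst (B <_) (sym A≡1+B) (n<1+n B)
    where
    A B : ℕ
    A = sumFin n (without w (row u))
    B = sumFin n (without u (row w))

    A≡1+B : A ≡ suc B
    A≡1+B = +-cancelˡ-≡ (ind (adj G u w)) A (suc B) (begin
      ind (adj G u w) + A        ≡⟨ sym (degree-without u w) ⟩
      degree G u                 ≡⟨ gap ⟩
      suc (degree G w)           ≡⟨ cong suc (degree-without w u) ⟩
      suc (ind (adj G w u) + B)  ≡⟨ cong (λ b → suc (ind b + B)) (Graph.sym G w u) ⟩
      suc (ind (adj G u w) + B)  ≡⟨ sym (+-suc _ B) ⟩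
      ind (adj G u w) + suc B    ∎)
      where open ≡-Reasoning

  gap⇒escaping-neighbour : ∀ u w → degree G u ≡ suc (degree G w) →
    ∃ λ x → x ≢ w × adj G u x ≡ true × adj G w x ≡ false
  gap⇒escaping-neighbour u w gap
    with sum-<-witness n (without u (row w)) (without w (row u)) (gap⇒without-gap u w gap)
  ... | x , x-escapes = x , escaping-neighbour u w x x-escapes

vertex-of-card : ∀ {n} {v x : Fin (suc n)} → v ≢ x → ∃ λ j → punchIn v j ≡ x
vertex-of-card v≢x = punchOut v≢x , punchIn-punchOut v≢x

module _ {n : ℕ} (G : Graph (suc n)) (v : Fin (suc n)) where

  private
    deg′ : Fin n → ℕ
    deg′ = degree (card G v)

  degree-card : ∀ j → degree G (punchIn v j) ≡ ind (adj G v (punchIn v j)) + deg′ j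
  degree-card j = begin
    degree G (punchIn v j)               ≡⟨ sum-punchIn n (row G (punchIn v j)) v ⟩
    ind (adj G (punchIn v j) v) + deg′ j ≡⟨ cong (λ b → ind b + deg′ j) (Graph.sym G (punchIn v j) v) ⟩
    ind (adj G v (punchIn v j)) + deg′ j ∎
    where open ≡-Reasoning

  degree-of-neighbour : ∀ j → adj G v (punchIn v j) ≡ true → degree G (punchIn v j) ≡ suc (deg′ j)
  degree-of-neighbour j v~j = trans (degree-card j) (cong (λ b → ind b + deg′ j) v~j)

  degree-of-non-neighbour : ∀ j → adj G v (punchIn v j) ≡ false → degree G (punchIn v j) ≡ deg′ j
  degree-of-non-neighbour j v≁j = trans (degree-card j) (cong (λ b → ind b + deg′ j) v≁j)

  SplittingPair : Set
  SplittingPair = ∃₂ λ (a b : Fin n) →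
    deg′ a ≡ deg′ b × adj G v (punchIn v a) ≡ true × adj G v (punchIn v b) ≡ false

  splitting-pair⇒not-ds : SplittingPair → ¬ dsCompletable G v
  splitting-pair⇒not-ds (a , b , a≈b , v~a , v≁b) ds with ds (deg′ a)
  ... | inj₁ all-neighbours     with () ← trans (sym (all-neighbours b (sym a≈b))) v≁b
  ... | inj₂ all-non-neighbours with () ← trans (sym v~a) (all-non-neighbours a refl)

  -- Without a splitting pair, for each d decide whether some vertex of degree d
  -- in G - v is a neighbour of v; if so all of them are, otherwise none is.
  no-splitting-pair⇒ds : ¬ SplittingPair → dsCompletable G v
  no-splitting-pair⇒ds no-pair d with any? (λ a → (deg′ a ≟ℕ d) ×-dec (adj G v (punchIn v a) ≟ᴮ true))
  ... | yes (a , a≈d , v~a) = inj₁ λ b b≈d → ¬-not λ v≁b →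
          no-pair (a , b , trans a≈d (sym b≈d) , v~a , v≁b)
  ... | no none             = inj₂ λ b b≈d → ¬-not λ v~b → none (b , b≈d , v~b)

  splitting-pair⇒gap : SplittingPair → DegreeGap G
  splitting-pair⇒gap (a , b , a≈b , v~a , v≁b) = punchIn v a , punchIn v b , (begin
    degree G (punchIn v a)       ≡⟨ degree-of-neighbour a v~a ⟩
    suc (deg′ a)                 ≡⟨ cong suc a≈b ⟩
    suc (deg′ b)                 ≡⟨ cong suc (sym (degree-of-non-neighbour b v≁b)) ⟩
    suc (degree G (punchIn v b)) ∎)
    where open ≡-Reasoning

  gap-across⇒splitting-pair : ∀ {u w} → v ≢ u → v ≢ w → adj G v u ≡ true → adj G v w ≡ false →
    degree G u ≡ suc (degree G w) → SplittingPair
  gap-across⇒splitting-pair v≢u v≢w with vertex-of-card v≢u | vertex-of-card v≢w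
  ... | a , refl | b , refl = λ v~a v≁b gap → a , b , suc-injective (begin
    suc (deg′ a)                 ≡⟨ sym (degree-of-neighbour a v~a) ⟩
    degree G (punchIn v a)       ≡⟨ gap ⟩
    suc (degree G (punchIn v b)) ≡⟨ cong suc (degree-of-non-neighbour b v≁b) ⟩
    suc (deg′ b)                 ∎) , v~a , v≁b
    where open ≡-Reasoning

-- A degree gap u, w yields a splitting pair at a neighbour of u that is not
-- adjacent to w.
gap⇒splitting-pair : ∀ {n} (G : Graph (suc n)) → DegreeGap G → ∃ λ v → SplittingPair G v
gap⇒splitting-pair G (u , w , gap) with gap⇒escaping-neighbour G u w gap
... | v , v≢w , u~v , w≁v = v , gap-across⇒splitting-pair G v v≢u v≢w
        (trans (Graph.sym G v u) u~v) (trans (Graph.sym G v w) w≁v) gap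
  where
  v≢u : v ≢ u
  v≢u refl with () ← trans (sym u~v) (irrefl G v)

theorem2 : (n : ℕ) (G : Graph n) →
    allDsCompletable G ⇔ (¬ ∃₂ λ (u w : Fin n) → degree G u ≡ suc (degree G w))
theorem2 zero    G = mk⇔ (λ _ ()) (λ _ → tt)
theorem2 (suc n) G = mk⇔
  (λ all-ds gap → let (v , pair) = gap⇒splitting-pair G gap in splitting-pair⇒not-ds G v pair (all-ds v))
  (λ no-gap v → no-splitting-pair⇒ds G v (no-gap ∘ splitting-pair⇒gap G v))
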